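{- Let $G$ be a $P_4$-sparse graph consisting of exactly two connected components with vertex sets $C_u\ni u$ and $C_v\ni v$. Let $H$ be an optimal solution of the ($P_4$-sparse-2CC,$+1$)-MinEdgeAddition Problem for $G$ and the non-edge $uv$ such that the root of the $P_4$-sparse tree $T_H$ of $H$ is a $1$-node, and suppose that the leaves corresponding to $u,v$ belong to distinct subtrees $T_1,T_2$, respectively, rooted at children of the root of $T_H$. Let $A$ be the set of vertices corresponding to the leaves of $T_1$ and $B=V(G)\setminus A$. Then it is not possible that both $A\cap C_v\ne\emptyset$ and $B\cap C_u\ne\emptyset$, and there exists an optimal solution of the same problem which results from making $u$ or $v$ universal in $G$.
   Context: All graphs are finite, simple, undirected. A graph is $P_4$-sparse if no five vertices induce more than one $P_4$. A spider is a graph with vertex partition $(S,K,R)$, $S$ independent, $K$ a clique, $|S|=|K|\ge2$, $R$ complete to $K$ and anticomplete to $S$, and a bijection $f:S\to K$ with either $N(s)\cap K=\{f(s)\}$ for all $s$ (thin) or $N(s)\cap K=K\setminus\{f(s)\}$ for all $s$ (thick). Every $P_4$-sparse graph has a unique $P_4$-sparse tree: a rooted tree whose leaves correspond bijectively to the vertices, internal nodes have at least two children and labels $0,1,2$ differing from the parent's label; two vertices are non-adjacent (adjacent) if the least common ancestor of their leaves is a $0$-node ($1$-node), and the leaves below a $2$-node induce a spider. "Making $u$ universal in $G$" means adding all edges from $u$ to its non-neighbours. ($P_4$-sparse-2CC,$+1$)-MinEdgeAddition Problem: $G$ is $P_4$-sparse with exactly two connected components $C_u\ni u$, $C_v\ni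 v$; a solution is a $P_4$-sparse $H$ with $V(H)=V(G)$, $E(G)\cup\{uv\}\subseteq E(H)$; fill edges are $E(H)\setminus E(G)$ (including $uv$); optimal solutions minimize their number. -}

module Defs where

open import Data.Nat using (ℕ; zero; suc; _≤_; _<ᵇ_)
open import Data.Bool using (Bool; true; false; if_then_else_; _∧_; not)
open import Data.Fin using (Fin; toℕ)
open import Data.Fin.Subset using (Subset; _∈_; _∉_; _∪_; ⁅_⁆; _⊆_; ∣_∣)
open import Data.List using (List; []; _∷_; length; lookup; allFin; map)
open import Data.Nat.ListAction using (sum)
open import Data.List.Relation.Unary.All using (All)
open import Data.List.Relation.Binary.Permutation.Propositional using (_↭_)
import Data.List.Membership.Propositional as LM
open import Data.Maybe using (Maybe; just; nothing)
open import Data.Product using (Σ; ∃; _×_; _,_)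
open import Data.Sum using (_⊎_)
open import Relation.Binary.PropositionalEquality using (_≡_; _≢_)
open import Relation.Nullary using (¬_)
open import Function.Bundles using (_⇔_)

record Graph (n : ℕ) : Set where
  field
    adj    : Fin n → Fin n → Bool
    sym    : ∀ x y → adj x y ≡ adj y x
    irrefl : ∀ x → adj x x ≡ false
open Graph public

module _ {n : ℕ} where

  Edge : Graph n → Fin n → Fin n → Set
  Edge G x y = adj G x y ≡ true

  EdgeSub : Graph n → Graph n → Set
  EdgeSub G H = ∀ x y → Edge G x y → Edge H x y

  fillCount : Graph n → Graph n → ℕ
  fillCount G H =
    sum (map (λ x → sum (map (λ y →
      if (toℕ x <ᵇ toℕ y) ∧ adj H x y ∧ not (adj G x y) then 1 else 0)
      (allFin n))) (allFin n))

  IsP4 : Graph n → Fin n → Fin n → Fin n → Fin n → Set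
  IsP4 G a b c d =
    (a ≢ b × a ≢ c × a ≢ d × b ≢ c × b ≢ d × c ≢ d) ×
    (Edge G a b × Edge G b c × Edge G c d) ×
    (¬ Edge G a c × ¬ Edge G a d × ¬ Edge G b d)

  set4 : Fin n → Fin n → Fin n → Fin n → Subset n
  set4 a b c d = ⁅ a ⁆ ∪ ⁅ b ⁆ ∪ ⁅ c ⁆ ∪ ⁅ d ⁆

  InducesP4 : Graph n → Subset n → Set
  InducesP4 G P = Σ (Fin n) λ a → Σ (Fin n) λ b → Σ (Fin n) λ c → Σ (Fin n) λ d →
    IsP4 G a b c d × set4 a b c d ≡ P

  P4Sparse : Graph n → Set
  P4Sparse G = ∀ (X P Q : Subset n) → ∣ X ∣ ≡ 5 →
    P ⊆ X → Q ⊆ X → InducesP4 G P → InducesP4 G Q → P ≡ Q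

  data Reach (G : Graph n) (x : Fin n) : Fin n → Set where
    here : Reach G x x
    step : ∀ {y z} → Reach G x y → Edge G y z → Reach G x z

  -- G has exactly two connected components, C_u ∋ u and C_v ∋ v
  -- (C_u = {w | Reach G u w}, C_v = {w | Reach G v w})
  TwoComponents : Graph n → Fin n → Fin n → Set
  TwoComponents G u v = ¬ Reach G u v × (∀ w → Reach G u w ⊎ Reach G v w)

  IsSolution : Graph n → Fin n → Fin n → Graph n → Set
  IsSolution G u v H = P4Sparse H × EdgeSub G H × Edge H u v

  IsOptimal : Graph n → Fin n → Fin n → Graph n → Set
  IsOptimal G u v H = IsSolution G u v H ×
    (∀ H' → IsSolution G u v H' → fillCount G H ≤ fillCount G H')

  MakesUniversal : Graph n → Fin n → Graph n → Set
  MakesUniversal G u H = ∀ x y →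
    Edge H x y ⇔ (Edge G x y ⊎ (x ≢ y × (x ≡ u ⊎ y ≡ u)))

  Spider : Graph n → Subset n → Set
  Spider G X = Σ (Subset n) λ S → Σ (Subset n) λ K → Σ (Subset n) λ R →
    Σ (Fin n → Fin n) λ f →
      (S ∪ K ∪ R ≡ X) ×
      (∀ x → x ∈ S → x ∉ K) × (∀ x → x ∈ S → x ∉ R) × (∀ x → x ∈ K → x ∉ R) ×
      (∀ x y → x ∈ S → y ∈ S → ¬ Edge G x y) ×
      (∀ x y → x ∈ K → y ∈ K → x ≢ y → Edge G x y) ×
      (∣ S ∣ ≡ ∣ K ∣) × (2 ≤ ∣ S ∣) ×
      (∀ r k → r ∈ R → k ∈ K → Edge G r k) ×
      (∀ r s → r ∈ R → s ∈ S → ¬ Edge G r s) ×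
      (∀ s → s ∈ S → f s ∈ K) ×
      (∀ s s' → s ∈ S → s' ∈ S → f s ≡ f s' → s ≡ s') ×
      (∀ k → k ∈ K → Σ (Fin n) λ s → s ∈ S × f s ≡ k) ×
      ((∀ s k → s ∈ S → k ∈ K → Edge G s k ⇔ (k ≡ f s)) ⊎
       (∀ s k → s ∈ S → k ∈ K → Edge G s k ⇔ (k ≢ f s)))

  data Label : Set where
    L0 L1 L2 : Label

  data Tree : Set where
    leaf : Fin n → Tree
    node : Label → List Tree → Tree

  leaves  : Tree → List (Fin n)
  leavesL : List Tree → List (Fin n)
  leaves (leaf x) = x ∷ []
  leaves (node _ ts) = leavesL ts
  leavesL [] = []
  leavesL (t ∷ ts) = leaves t Data.List.++ leavesL ts

  toSubset : List (Fin n) → Subset n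
  toSubset [] = Data.Fin.Subset.⊥
  toSubset (x ∷ xs) = ⁅ x ⁆ ∪ toSubset xs

  NodeCond : Graph n → Label → List Tree → Set
  NodeCond H L0 ts = ∀ (i j : Fin (length ts)) → i ≢ j → ∀ x y →
    x LM.∈ leaves (lookup ts i) → y LM.∈ leaves (lookup ts j) → ¬ Edge H x y
  NodeCond H L1 ts = ∀ (i j : Fin (length ts)) → i ≢ j → ∀ x y →
    x LM.∈ leaves (lookup ts i) → y LM.∈ leaves (lookup ts j) → Edge H x y
  NodeCond H L2 ts = Spider H (toSubset (leavesL ts))

  -- well-formed subtree, given the label of its parent (nothing at the root)
  data WF (H : Graph n) : Maybe Label → Tree → Set where
    leafWF : ∀ {p} x → WF H p (leaf x)
    nodeWF : ∀ {p} ℓ ts → p ≢ just ℓ → 2 ≤ length ts →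
             All (WF H (just ℓ)) ts → NodeCond H ℓ ts → WF H p (node ℓ ts)

  IsP4SparseTree : Graph n → Tree → Set
  IsP4SparseTree H T = WF H nothing T × (leaves T ↭ allFin n)

module Submission where

-- Write U = C_u and V = C_v. Since H is complete between A ∋ u and B ∋ v, every pair {a, b} with
-- a ∈ A, b ∈ B that is not an edge of G is a fill edge of H. Making u universal costs one fill edge
-- per non-neighbour y of u, and charging y to the cross non-edge uy (y ∈ B), yv (y ∈ A ∩ U) or
-- yx (y ∈ A ∩ V, for a fixed x ∈ B ∩ U) is injective. Hence making u universal is optimal when
-- A ∩ V = ∅, and symmetrically making v universal is optimal when B ∩ U = ∅.
-- If both w ∈ A ∩ V and x ∈ B ∩ U exist, optimality of H forces every cross non-edge to be
-- charged, from u's side and from v's side. This gives B ∩ U = {x}, A ∩ V = {w}, N(u) = {x},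
-- N(v) = {w}, w adjacent to all of B ∩ V, and A ∩ U = {u} or B ∩ V = {v}; by symmetry
-- A ∩ U = {u}. Adding one, two or three edges (as |B ∩ V| is 1, 2 or larger) then gives a
-- P4-sparse solution that is cheaper than H.

open import Data.Bool using (Bool; true; false; if_then_else_; _∧_; _∨_; not)
import Data.Bool.Properties as Bool
open import Data.Empty using (⊥; ⊥-elim)
open import Data.Fin using (Fin; zero; suc; toℕ)
import Data.Fin as Fin
open import Data.Fin.Properties using (_≟_; injective⇒≤; any?)
import Data.Fin.Properties as Fin
open import Data.Fin.Subset using (Subset; ⁅_⁆; _∪_; _∈_; _∉_)
open import Data.Fin.Subset.Properties
  using (∪-comm; ∪-assoc; x∈p∪q⁺; x∈p∪q⁻; x∈⁅x⁆; x∈⁅y⁆⇒x≡y; ∉⊥; _∈?_)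
open import Data.List using (List; []; _∷_; _++_; length; lookup; allFin; map; filter; cartesianProduct)
open import Data.List.Properties using (length-++; filter-++; length-map)
import Data.List.Membership.DecPropositional as DecMembership
import Data.List.Membership.Propositional as LM
open LM using () renaming (_∈_ to _∈ₗ_)
open import Data.List.Membership.Propositional.Properties
  using (∈-filter⁺; ∈-filter⁻; ∈-allFin; ∈-cartesianProduct⁺; ∈-lookup; ∈-map⁺; ∈-++⁻)
open import Data.List.Relation.Binary.Permutation.Propositional using (_↭_; ↭-sym)
open import Data.List.Relation.Binary.Permutation.Propositional.Properties using (∈-resp-↭)
open import Data.List.Relation.Unary.All as All using (All; []; _∷_)
import Data.List.Relation.Unary.All.Properties as All
open import Data.List.Relation.Unary.AllPairs using ([]; _∷_)
open import Data.List.Relation.Unary.Any as Any using (Any; here; there; index)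
open import Data.List.Relation.Unary.Any.Properties using (lookup-index)
open import Data.List.Relation.Unary.Unique.Propositional using (Unique)
open import Data.List.Relation.Unary.Unique.Propositional.Properties using (cartesianProduct⁺; filter⁺; allFin⁺)
open import Data.Nat using (ℕ; zero; suc; _≤_; _<_; _+_; _<ᵇ_)
import Data.Nat.Properties as ℕ
open import Data.Nat.ListAction using (sum)
open import Data.Product using (Σ; _×_; _,_; proj₁; proj₂; uncurry)
open import Data.Product.Properties using (≡-dec; ,-injectiveˡ; ,-injectiveʳ)
open import Data.Sum using (_⊎_; inj₁; inj₂)
open import Function using (_∘_)
open import Function.Bundles using (_⇔_; mk⇔; Equivalence)
open import Relation.Binary using (tri<; tri≈; tri>)
open import Relation.Binary.PropositionalEquality
  using (_≡_; _≢_; refl; sym; trans; cong; cong₂; subst; module ≡-Reasoning)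
open import Relation.Nullary using (¬_; Dec; yes; no; does)
open import Relation.Nullary.Decidable
  using (dec-true; dec-false; does-⇔; _⊎-dec_; _×-dec_; ¬?; decidable-stable)

open import Defs hiding (sym)

-- Counting pairs of vertices

Pair : ℕ → Set
Pair n = Fin n × Fin n

module _ {n : ℕ} where

  count : (Fin n → Fin n → Bool) → ℕ
  count b = sum (map (λ x → sum (map (λ y → if b x y then 1 else 0) (allFin n))) (allFin n))

  Holds : (Fin n → Fin n → Bool) → Pair n → Set
  Holds b (x , y) = b x y ≡ true

  private
    holds? : ∀ b (p : Pair n) → Dec (Holds b p)
    holds? b (x , y) = b x y Bool.≟ true

    holding : (Fin n → Fin n → Bool) → List (Pair n)
    holding b = filter (holds? b) (cartesianProduct (allFin n) (allFin n))

    length-holding-row : ∀ b x ys → length (filter (holds? b) (map (x ,_) ys)) ≡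
                         sum (map (λ y → if b x y then 1 else 0) ys)
    length-holding-row b x [] = refl
    length-holding-row b x (y ∷ ys) with b x y
    ... | true  = cong suc (length-holding-row b x ys)
    ... | false = length-holding-row b x ys

    length-holding : ∀ b xs ys → length (filter (holds? b) (cartesianProduct xs ys)) ≡
                     sum (map (λ x → sum (map (λ y → if b x y then 1 else 0) ys)) xs)
    length-holding b [] ys = refl
    length-holding b (x ∷ xs) ys = begin
      length (filter (holds? b) (map (x ,_) ys ++ cartesianProduct xs ys))
        ≡⟨ cong length (filter-++ (holds? b) (map (x ,_) ys) (cartesianProduct xs ys)) ⟩
      length (filter (holds? b) (map (x ,_) ys) ++ filter (holds? b) (cartesianProduct xs ys))
        ≡⟨ length-++ (filter (holds? b) (map (x ,_) ys)) ⟩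
      length (filter (holds? b) (map (x ,_) ys)) + length (filter (holds? b) (cartesianProduct xs ys))
        ≡⟨ cong₂ _+_ (length-holding-row b x ys) (length-holding b xs ys) ⟩
      sum (map (λ y → if b x y then 1 else 0) ys) + sum (map (λ x → sum (map (λ y → if b x y then 1 else 0) ys)) xs) ∎
      where open ≡-Reasoning

    count≡length : ∀ b → count b ≡ length (holding b)
    count≡length b = sym (length-holding b (allFin n) (allFin n))

    ∈-holding : ∀ {b p} → Holds b p → p ∈ₗ holding b
    ∈-holding {b} {x , y} h = ∈-filter⁺ (holds? b) (∈-cartesianProduct⁺ (∈-allFin x) (∈-allFin y)) h

    holding-unique : ∀ b → Unique (holding b)
    holding-unique b = filter⁺ (holds? b) (cartesianProduct⁺ (allFin⁺ n) (allFin⁺ n))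

    lookup-holds : ∀ b i → Holds b (lookup (holding b) i)
    lookup-holds b i = proj₂ (∈-filter⁻ (holds? b) {xs = cartesianProduct (allFin n) (allFin n)} (∈-lookup i))

    index-injective : ∀ {A : Set} {xs : List A} {x y} (p : x ∈ₗ xs) (q : y ∈ₗ xs) → index p ≡ index q → x ≡ y
    index-injective {xs = xs} p q eq = trans (lookup-index p) (trans (cong (lookup xs) eq) (sym (lookup-index q)))

    lookup-injective : ∀ {A : Set} {xs : List A} → Unique xs → ∀ {i j} → lookup xs i ≡ lookup xs j → i ≡ j
    lookup-injective {xs = _ ∷ _} _             {zero}  {zero}  _  = refl
    lookup-injective {xs = _ ∷ _} (x∉ ∷ _)      {zero}  {suc j} eq = ⊥-elim (All.lookup x∉ (∈-lookup j) eq)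
    lookup-injective {xs = _ ∷ _} (x∉ ∷ _)      {suc i} {zero}  eq = ⊥-elim (All.lookup x∉ (∈-lookup i) (sym eq))
    lookup-injective {xs = _ ∷ _} (_ ∷ unique)  {suc i} {suc j} eq = cong suc (lookup-injective unique eq)

  module _ {b b' : Fin n → Fin n → Bool} (f : ∀ p → Holds b p → Pair n)
           (f-holds : ∀ p (h : Holds b p) → Holds b' (f p h))
           (f-injective : ∀ p q (hp : Holds b p) (hq : Holds b q) → f p hp ≡ f q hq → p ≡ q) where

    private
      image : Fin (length (holding b)) → Fin (length (holding b'))
      image i = index (∈-holding (f-holds _ (lookup-holds b i)))

      image-injective : ∀ {i j} → image i ≡ image j → i ≡ j
      image-injective eq = lookup-injective (holding-unique b)
        (f-injective _ _ _ _ (index-injective (∈-holding (f-holds _ _)) (∈-holding (f-holds _ _)) eq))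

    count-≤-injection : count b ≤ count b'
    count-≤-injection rewrite count≡length b | count≡length b' = injective⇒≤ image-injective

    count-<-injection : (e : Pair n) → Holds b' e → (∀ p (h : Holds b p) → f p h ≢ e) → count b < count b'
    count-<-injection e he missed rewrite count≡length b | count≡length b' =
      injective⇒≤ {f = image⁺} image⁺-injective
      where
      image⁺ : Fin (suc (length (holding b))) → Fin (length (holding b'))
      image⁺ zero    = index (∈-holding he)
      image⁺ (suc i) = image i

      image⁺-injective : ∀ {i j} → image⁺ i ≡ image⁺ j → i ≡ j
      image⁺-injective {zero}  {zero}  _  = refl
      image⁺-injective {zero}  {suc j} eq =
        ⊥-elim (missed _ _ (sym (index-injective (∈-holding he) (∈-holding (f-holds _ _)) eq)))
      image⁺-injective {suc i} {zero}  eq =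
        ⊥-elim (missed _ _ (index-injective (∈-holding (f-holds _ _)) (∈-holding he) eq))
      image⁺-injective {suc i} {suc j} eq = cong suc (image-injective eq)

  length≤count : ∀ {b} (xs : List (Pair n)) → Unique xs → All (Holds b) xs → length xs ≤ count b
  length≤count {b} xs unique all rewrite count≡length b =
    injective⇒≤ {f = λ i → index (∈-holding (All.lookup all (∈-lookup i)))}
      (λ eq → lookup-injective unique (index-injective (∈-holding _) (∈-holding _) eq))

  count≤length : ∀ {b} (xs : List (Pair n)) → (∀ {p} → Holds b p → p ∈ₗ xs) → count b ≤ length xs
  count≤length {b} xs covered rewrite count≡length b =
    injective⇒≤ {f = λ i → index (covered (lookup-holds b i))}
      (λ eq → lookup-injective (holding-unique b) (index-injective (covered _) (covered _) eq))

module _ {n : ℕ} where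

  -- Edges and edge additions

  edge-sym : (G : Graph n) {x y : Fin n} → Edge G x y → Edge G y x
  edge-sym G {x} {y} e = trans (Graph.sym G y x) e

  edge-irrefl : (G : Graph n) {x y : Fin n} → Edge G x y → x ≢ y
  edge-irrefl G {x} e refl with trans (sym (irrefl G x)) e
  ... | ()

  edge? : (G : Graph n) → ∀ x y → Dec (Edge G x y)
  edge? G x y = adj G x y Bool.≟ true

  extend : (G : Graph n) {E : Fin n → Fin n → Set} → (∀ x y → Dec (E x y)) → Graph n
  extend G E? = record
    { adj    = λ x y → adj G x y ∨ (not (does (x ≟ y)) ∧ (does (E? x y) ∨ does (E? y x)))
    ; sym    = λ x y → cong₂ _∨_ (Graph.sym G x y)
                         (cong₂ _∧_ (cong not (does-⇔ (mk⇔ sym sym) (x ≟ y) (y ≟ x)))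
                                    (Bool.∨-comm (does (E? x y)) (does (E? y x))))
    ; irrefl = λ x → cong₂ _∨_ (irrefl G x) (cong (λ b → not b ∧ _) (dec-true (x ≟ x) refl))
    }

  module _ (G : Graph n) {E : Fin n → Fin n → Set} (E? : ∀ x y → Dec (E x y)) where

    extend-edge⇔ : ∀ x y → Edge (extend G E?) x y ⇔ (Edge G x y ⊎ (x ≢ y × (E x y ⊎ E y x)))
    extend-edge⇔ x y = mk⇔ to from
      where
      to : Edge (extend G E?) x y → Edge G x y ⊎ (x ≢ y × (E x y ⊎ E y x))
      to e with adj G x y | x ≟ y | E? x y | E? y x
      ... | true  | _       | _       | _       = inj₁ refl
      ... | false | no x≢y  | yes exy | _       = inj₂ (x≢y , inj₁ exy)
      ... | false | no x≢y  | no _    | yes eyx = inj₂ (x≢y , inj₂ eyx)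
      ... | false | no _    | no _    | no _    with () ← e
      ... | false | yes _   | _       | _       with () ← e

      from : Edge G x y ⊎ (x ≢ y × (E x y ⊎ E y x)) → Edge (extend G E?) x y
      from (inj₁ e) rewrite e = refl
      from (inj₂ (x≢y , exy)) rewrite dec-false (x ≟ y) x≢y with exy | E? x y | E? y x
      ... | _        | yes _ | _       = Bool.∨-zeroʳ (adj G x y)
      ... | _        | no _  | yes _   = Bool.∨-zeroʳ (adj G x y)
      ... | inj₁ exy | no ¬exy | no _  = ⊥-elim (¬exy exy)
      ... | inj₂ eyx | no _  | no ¬eyx = ⊥-elim (¬eyx eyx)

    extend-⊇ : EdgeSub G (extend G E?)
    extend-⊇ x y e = Equivalence.from (extend-edge⇔ x y) (inj₁ e)

  makeUniversal : Graph n → Fin n → Graph n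
  makeUniversal G c = extend G (λ x _ → x ≟ c)

  makeUniversal-spec : (G : Graph n) (c : Fin n) → MakesUniversal G c (makeUniversal G c)
  makeUniversal-spec G c = extend-edge⇔ G (λ x _ → x ≟ c)

  makeUniversal-⊇ : (G : Graph n) (c : Fin n) → EdgeSub G (makeUniversal G c)
  makeUniversal-⊇ G c = extend-⊇ G (λ x _ → x ≟ c)

  makeUniversal-universal : (G : Graph n) (c : Fin n) → ∀ t → c ≢ t → Edge (makeUniversal G c) c t
  makeUniversal-universal G c t c≢t = Equivalence.from (makeUniversal-spec G c c t) (inj₂ (c≢t , inj₁ refl))

  _∈ₗ?_ : (p : Pair n) (ps : List (Pair n)) → Dec (p ∈ₗ ps)
  _∈ₗ?_ = DecMembership._∈?_ (≡-dec _≟_ _≟_)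

  addEdges : Graph n → List (Pair n) → Graph n
  addEdges G ps = extend G (λ x y → (x , y) ∈ₗ? ps)

  addEdges-edge⇔ : ∀ G ps x y →
    Edge (addEdges G ps) x y ⇔ (Edge G x y ⊎ (x ≢ y × ((x , y) ∈ₗ ps ⊎ (y , x) ∈ₗ ps)))
  addEdges-edge⇔ G ps = extend-edge⇔ G (λ x y → (x , y) ∈ₗ? ps)

  Link : Fin n → Fin n → Fin n → Fin n → Set
  Link p q a b = (a ≡ p × b ≡ q) ⊎ (a ≡ q × b ≡ p)

  addEdges-edge⁻ : ∀ {G ps a b} → Edge (addEdges G ps) a b → Edge G a b ⊎ Any (λ e → Link (proj₁ e) (proj₂ e) a b) ps
  addEdges-edge⁻ {G} {ps} {a} {b} e with Equivalence.to (addEdges-edge⇔ G ps a b) e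
  ... | inj₁ e′               = inj₁ e′
  ... | inj₂ (_ , inj₁ ab∈ps) = inj₂ (Any.map (λ { refl → inj₁ (refl , refl) }) ab∈ps)
  ... | inj₂ (_ , inj₂ ba∈ps) = inj₂ (Any.map (λ { refl → inj₂ (refl , refl) }) ba∈ps)

  addEdges-edge⁺ : ∀ {G ps a b} → (a , b) ∈ₗ ps → a ≢ b → Edge (addEdges G ps) a b
  addEdges-edge⁺ {G} {ps} {a} {b} ab∈ps a≢b = Equivalence.from (addEdges-edge⇔ G ps a b) (inj₂ (a≢b , inj₁ ab∈ps))

  addEdges-⊇ : ∀ G ps → EdgeSub G (addEdges G ps)
  addEdges-⊇ G ps = extend-⊇ G (λ x y → (x , y) ∈ₗ? ps)

  -- Fill pairs

  sortPair : Fin n → Fin n → Pair n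
  sortPair a b = if toℕ a <ᵇ toℕ b then (a , b) else (b , a)

  -- fillCount G H is count (fillBit G H) by definition.
  fillBit : Graph n → Graph n → Fin n → Fin n → Bool
  fillBit G H x y = (toℕ x <ᵇ toℕ y) ∧ adj H x y ∧ not (adj G x y)

  FillPair : Graph n → Graph n → Pair n → Set
  FillPair G H = Holds (fillBit G H)

  private
    <ᵇ-true : ∀ {m k} → m < k → (m <ᵇ k) ≡ true
    <ᵇ-true lt = Equivalence.to Bool.T-≡ (ℕ.<⇒<ᵇ lt)

  sortPair-< : {a b : Fin n} → a Fin.< b → sortPair a b ≡ (a , b)
  sortPair-< lt rewrite <ᵇ-true lt = refl

  sortPair-> : {a b : Fin n} → b Fin.< a → sortPair a b ≡ (b , a)
  sortPair-> {a} {b} gt with toℕ a <ᵇ toℕ b in lt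
  ... | false = refl
  ... | true  = ⊥-elim (ℕ.<-asym gt (ℕ.<ᵇ⇒< _ _ (Equivalence.from Bool.T-≡ lt)))

  sortPair-comm : (a b : Fin n) → sortPair a b ≡ sortPair b a
  sortPair-comm a b with Fin.<-cmp a b
  ... | tri< lt _ _   = trans (sortPair-< lt) (sym (sortPair-> lt))
  ... | tri≈ _ refl _ = refl
  ... | tri> _ _ gt   = trans (sortPair-> gt) (sym (sortPair-< gt))

  sortPair-injective : {a b c d : Fin n} → sortPair a b ≡ sortPair c d → (a ≡ c × b ≡ d) ⊎ (a ≡ d × b ≡ c)
  sortPair-injective {a} {b} {c} {d} eq with toℕ a <ᵇ toℕ b | toℕ c <ᵇ toℕ d
  ... | true  | true  = inj₁ (,-injectiveˡ eq , ,-injectiveʳ eq)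
  ... | true  | false = inj₂ (,-injectiveˡ eq , ,-injectiveʳ eq)
  ... | false | true  = inj₂ (,-injectiveʳ eq , ,-injectiveˡ eq)
  ... | false | false = inj₁ (,-injectiveʳ eq , ,-injectiveˡ eq)

  fillPair⁻ : ∀ {G H : Graph n} {x y} → FillPair G H (x , y) →
              x Fin.< y × Edge H x y × ¬ Edge G x y
  fillPair⁻ {G} {H} {x} {y} h with toℕ x <ᵇ toℕ y in lt | adj H x y | adj G x y
  ... | true  | true  | false = ℕ.<ᵇ⇒< _ _ (Equivalence.from Bool.T-≡ lt) , refl , λ ()
  ... | true  | true  | true  with () ← h
  ... | true  | false | _     with () ← h
  ... | false | _     | _     with () ← h

  fillPair-sortPair : ∀ {G H : Graph n} {a b} → a ≢ b → Edge H a b → ¬ Edge G a b → FillPair G H (sortPair a b)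
  fillPair-sortPair {G} {H} {a} {b} a≢b e ¬e with Fin.<-cmp a b
  ... | tri< lt _ _ rewrite sortPair-< lt | <ᵇ-true lt | e | Bool.¬-not ¬e = refl
  ... | tri≈ _ a≡b _ = ⊥-elim (a≢b a≡b)
  ... | tri> _ _ gt rewrite sortPair-> gt | <ᵇ-true gt | edge-sym H e | Bool.¬-not (¬e ∘ edge-sym G) = refl

  fillPair-sorted : ∀ {G H : Graph n} {x y} → FillPair G H (x , y) → (x , y) ≡ sortPair x y
  fillPair-sorted {G} {H} h = sym (sortPair-< (proj₁ (fillPair⁻ {G} {H} h)))

  addEdges-fillCount : (G : Graph n) (ps : List (Pair n)) → fillCount G (addEdges G ps) ≤ length ps
  addEdges-fillCount G ps = subst (fillCount G (addEdges G ps) ≤_) (length-map (uncurry sortPair) ps)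
    (count≤length (map (uncurry sortPair) ps) covered)
    where
    covered : ∀ {p} → FillPair G (addEdges G ps) p → p ∈ₗ map (uncurry sortPair) ps
    covered {x , y} h with fillPair⁻ {G} {addEdges G ps} h
    ... | _ , e , ¬e with Equivalence.to (addEdges-edge⇔ G ps x y) e
    ... | inj₁ e′               = ⊥-elim (¬e e′)
    ... | inj₂ (_ , inj₁ xy∈ps) =
          subst (_∈ₗ _) (sym (fillPair-sorted {G} {addEdges G ps} h)) (∈-map⁺ (uncurry sortPair) xy∈ps)
    ... | inj₂ (_ , inj₂ yx∈ps) =
          subst (_∈ₗ _) (trans (sortPair-comm y x) (sym (fillPair-sorted {G} {addEdges G ps} h)))
            (∈-map⁺ (uncurry sortPair) yx∈ps)

  NonNeighbour : Graph n → Fin n → Fin n → Set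
  NonNeighbour G c y = y ≢ c × ¬ Edge G c y

  private
    otherEnd : Fin n → Pair n → Fin n
    otherEnd c (x , y) with x ≟ c
    ... | yes _ = y
    ... | no _  = x

    makeUniversal-fillPair : ∀ G c {p} → FillPair G (makeUniversal G c) p →
                             NonNeighbour G c (otherEnd c p) × p ≡ sortPair c (otherEnd c p)
    makeUniversal-fillPair G c {x , y} h with fillPair⁻ {G} {makeUniversal G c} h
    ... | _ , e , ¬e with Equivalence.to (makeUniversal-spec G c x y) e | x ≟ c
    ... | inj₁ e′ | _ = ⊥-elim (¬e e′)
    ... | inj₂ (x≢y , _) | yes refl = (x≢y ∘ sym , ¬e) , fillPair-sorted {G} {makeUniversal G c} h
    ... | inj₂ (_ , inj₁ x≡c) | no x≢c = ⊥-elim (x≢c x≡c)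
    ... | inj₂ (_ , inj₂ refl) | no x≢c =
          (x≢c , ¬e ∘ edge-sym G) , trans (fillPair-sorted {G} {makeUniversal G c} h) (sortPair-comm x c)

  module _ (G H : Graph n) (c : Fin n) (ψ : Fin n → Pair n)
           (ψ-fill : ∀ {y} → NonNeighbour G c y → FillPair G H (ψ y))
           (ψ-injective : ∀ {y y′} → NonNeighbour G c y → NonNeighbour G c y′ → ψ y ≡ ψ y′ → y ≡ y′) where

    private
      f : ∀ p → FillPair G (makeUniversal G c) p → Pair n
      f p _ = ψ (otherEnd c p)

      f-fill : ∀ p (h : FillPair G (makeUniversal G c) p) → FillPair G H (f p h)
      f-fill p h = ψ-fill (proj₁ (makeUniversal-fillPair G c {p} h))

      f-injective : ∀ p q (hp : FillPair G (makeUniversal G c) p) (hq : FillPair G (makeUniversal G c) q) →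
                    f p hp ≡ f q hq → p ≡ q
      f-injective p q hp hq eq with makeUniversal-fillPair G c {p} hp | makeUniversal-fillPair G c {q} hq
      ... | nn , p≡ | nn′ , q≡ = trans p≡ (trans (cong (sortPair c) (ψ-injective nn nn′ eq)) (sym q≡))

    makeUniversal-fillCount-≤ : fillCount G (makeUniversal G c) ≤ fillCount G H
    makeUniversal-fillCount-≤ = count-≤-injection f f-fill f-injective

    makeUniversal-fillCount-< : (e : Pair n) → FillPair G H e → (∀ {y} → NonNeighbour G c y → ψ y ≢ e) →
                                fillCount G (makeUniversal G c) < fillCount G H
    makeUniversal-fillCount-< e he missed =
      count-<-injection f f-fill f-injective e he (λ p h → missed (proj₁ (makeUniversal-fillPair G c {p} h)))

  -- Induced P4s

  P4Sparse-reflect : {S G : Graph n} → (∀ {a b c d} → IsP4 S a b c d → IsP4 G a b c d) → P4Sparse G → P4Sparse S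
  P4Sparse-reflect S⇒G sparse X P Q ∣X∣≡5 P⊆X Q⊆X (a , b , c , d , p4 , eq) (a′ , b′ , c′ , d′ , p4′ , eq′) =
    sparse X P Q ∣X∣≡5 P⊆X Q⊆X (a , b , c , d , S⇒G p4 , eq) (a′ , b′ , c′ , d′ , S⇒G p4′ , eq′)

  P4Sparse-single : {S : Graph n} (K : Subset n) → (∀ {a b c d} → IsP4 S a b c d → set4 a b c d ≡ K) → P4Sparse S
  P4Sparse-single K onK X P Q _ _ _ (_ , _ , _ , _ , p4 , eq) (_ , _ , _ , _ , p4′ , eq′) =
    trans (sym eq) (trans (onK p4) (sym (trans (sym eq′) (onK p4′))))

  IsP4-reverse : {S : Graph n} {a b c d : Fin n} → IsP4 S a b c d → IsP4 S d c b a
  IsP4-reverse {S} ((a≢b , a≢c , a≢d , b≢c , b≢d , c≢d) , (ab , bc , cd) , (¬ac , ¬ad , ¬bd)) =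
    (c≢d ∘ sym , b≢d ∘ sym , a≢d ∘ sym , b≢c ∘ sym , a≢c ∘ sym , a≢b ∘ sym) ,
    (edge-sym S cd , edge-sym S bc , edge-sym S ab) ,
    (¬bd ∘ edge-sym S , ¬ad ∘ edge-sym S , ¬ac ∘ edge-sym S)

  set4-reverse : (a b c d : Fin n) → set4 d c b a ≡ set4 a b c d
  set4-reverse a b c d = begin
    ⁅ d ⁆ ∪ (⁅ c ⁆ ∪ (⁅ b ⁆ ∪ ⁅ a ⁆)) ≡⟨ cong (λ X → ⁅ d ⁆ ∪ (⁅ c ⁆ ∪ X)) (∪-comm ⁅ b ⁆ ⁅ a ⁆) ⟩
    ⁅ d ⁆ ∪ (⁅ c ⁆ ∪ (⁅ a ⁆ ∪ ⁅ b ⁆)) ≡⟨ cong (⁅ d ⁆ ∪_) (∪-comm ⁅ c ⁆ (⁅ a ⁆ ∪ ⁅ b ⁆)) ⟩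
    ⁅ d ⁆ ∪ ((⁅ a ⁆ ∪ ⁅ b ⁆) ∪ ⁅ c ⁆) ≡⟨ cong (⁅ d ⁆ ∪_) (∪-assoc ⁅ a ⁆ ⁅ b ⁆ ⁅ c ⁆) ⟩
    ⁅ d ⁆ ∪ (⁅ a ⁆ ∪ (⁅ b ⁆ ∪ ⁅ c ⁆)) ≡⟨ ∪-comm ⁅ d ⁆ _ ⟩
    (⁅ a ⁆ ∪ (⁅ b ⁆ ∪ ⁅ c ⁆)) ∪ ⁅ d ⁆ ≡⟨ ∪-assoc ⁅ a ⁆ _ ⁅ d ⁆ ⟩
    ⁅ a ⁆ ∪ ((⁅ b ⁆ ∪ ⁅ c ⁆) ∪ ⁅ d ⁆) ≡⟨ cong (⁅ a ⁆ ∪_) (∪-assoc ⁅ b ⁆ ⁅ c ⁆ ⁅ d ⁆) ⟩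
    ⁅ a ⁆ ∪ (⁅ b ⁆ ∪ (⁅ c ⁆ ∪ ⁅ d ⁆)) ∎
    where open ≡-Reasoning

  IsP4-transport : {S G : Graph n} (O : Fin n → Set) →
    (∀ {x y} → O x → O y → Edge S x y → Edge G x y) → (∀ {x y} → O x → O y → Edge G x y → Edge S x y) →
    ∀ {a b c d} → O a → O b → O c → O d → IsP4 S a b c d → IsP4 G a b c d
  IsP4-transport O S⇒G G⇒S oa ob oc od (distinct , (ab , bc , cd) , (¬ac , ¬ad , ¬bd)) =
    distinct , (S⇒G oa ob ab , S⇒G ob oc bc , S⇒G oc od cd) ,
    (¬ac ∘ G⇒S oa oc , ¬ad ∘ G⇒S oa od , ¬bd ∘ G⇒S ob od)

  -- In an induced P4 every vertex has a non-neighbour among the other three.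
  universal-∉-P4 : {S : Graph n} (s : Fin n) → (∀ t → s ≢ t → Edge S s t) →
    ∀ {a b c d} → IsP4 S a b c d → a ≢ s × b ≢ s × c ≢ s × d ≢ s
  universal-∉-P4 {S} s universal ((_ , a≢c , _ , _ , b≢d , _) , _ , (¬ac , _ , ¬bd)) =
    (λ { refl → ¬ac (universal _ a≢c) }) ,
    (λ { refl → ¬bd (universal _ b≢d) }) ,
    (λ { refl → ¬ac (edge-sym S (universal _ (a≢c ∘ sym))) }) ,
    (λ { refl → ¬bd (edge-sym S (universal _ (b≢d ∘ sym))) })

  makeUniversal-P4Sparse : (G : Graph n) (c : Fin n) → P4Sparse G → P4Sparse (makeUniversal G c)
  makeUniversal-P4Sparse G c = P4Sparse-reflect {S} {G} reflect
    where
    S = makeUniversal G c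

    S⇒G : ∀ {x y} → x ≢ c → y ≢ c → Edge S x y → Edge G x y
    S⇒G {x} {y} x≢c y≢c e with Equivalence.to (makeUniversal-spec G c x y) e
    ... | inj₁ e′                = e′
    ... | inj₂ (_ , inj₁ x≡c)    = ⊥-elim (x≢c x≡c)
    ... | inj₂ (_ , inj₂ y≡c)    = ⊥-elim (y≢c y≡c)

    reflect : ∀ {a b c′ d} → IsP4 S a b c′ d → IsP4 G a b c′ d
    reflect p4 with universal-∉-P4 {S} c (makeUniversal-universal G c) p4
    ... | oa , ob , oc , od = IsP4-transport {S} {G} (_≢ c) S⇒G (λ _ _ → makeUniversal-⊇ G c _ _) oa ob oc od p4

  module _ {S G : Graph n} (s : Fin n) (X : Fin n → Set) (X? : ∀ y → Dec (X y))
           (universal : ∀ t → s ≢ t → Edge S s t)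
           (separated : ∀ {y y′} → y ≢ s → ¬ X y → X y′ → ¬ Edge S y y′)
           (X-P4-free : ∀ {a b c d} → X a → X b → X c → X d → ¬ IsP4 S a b c d)
           (S⇒G : ∀ {x y} → x ≢ s → ¬ X x → y ≢ s → ¬ X y → Edge S x y → Edge G x y)
           (G⊆S : EdgeSub G S) where

    private
      X-closed : ∀ {y y′} → Edge S y y′ → X y → y′ ≢ s → X y′
      X-closed {y′ = y′} e xy y′≢s with X? y′
      ... | yes xy′ = xy′
      ... | no ¬xy′ = ⊥-elim (separated y′≢s ¬xy′ xy (edge-sym S e))

    -- An induced P4 misses the universal vertex s and is connected, so it lies inside X or outside X.
    universal-island-P4 : ∀ {a b c d} → IsP4 S a b c d → IsP4 G a b c d
    universal-island-P4 {a} p4@(_ , (ab , bc , cd) , _) with universal-∉-P4 {S} s universal p4 | X? a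
    ... | a≢s , b≢s , c≢s , d≢s | yes xa =
          let xb = X-closed ab xa b≢s ; xc = X-closed bc xb c≢s in
          ⊥-elim (X-P4-free xa xb xc (X-closed cd xc d≢s) p4)
    ... | a≢s , b≢s , c≢s , d≢s | no ¬xa =
          IsP4-transport {S} {G} (λ y → y ≢ s × ¬ X y)
            (λ (x≢s , ¬xx) (y≢s , ¬xy) → S⇒G x≢s ¬xx y≢s ¬xy) (λ _ _ → G⊆S _ _)
            (a≢s , ¬xa) (b≢s , ¬xb) (c≢s , ¬xc) (d≢s , ¬xc ∘ (λ xd → X-closed (edge-sym S cd) xd c≢s)) p4
      where
      ¬xb = λ xb → ¬xa (X-closed (edge-sym S ab) xb a≢s)
      ¬xc = λ xc → ¬xb (X-closed (edge-sym S bc) xc b≢s)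

  OneOf3 : Fin n → Fin n → Fin n → Fin n → Set
  OneOf3 p q r y = y ≡ p ⊎ y ≡ q ⊎ y ≡ r

  oneOf3? : ∀ p q r y → Dec (OneOf3 p q r y)
  oneOf3? p q r y = (y ≟ p) ⊎-dec (y ≟ q) ⊎-dec (y ≟ r)

  private
    three-in-two : ∀ {q r y y′ y″ : Fin n} → y ≡ q ⊎ y ≡ r → y′ ≡ q ⊎ y′ ≡ r → y″ ≡ q ⊎ y″ ≡ r →
                   y ≢ y′ → y ≢ y″ → y′ ≢ y″ → ⊥
    three-in-two (inj₁ refl) (inj₁ refl) _          d₁ _  _  = d₁ refl
    three-in-two (inj₂ refl) (inj₂ refl) _          d₁ _  _  = d₁ refl
    three-in-two (inj₁ refl) _          (inj₁ refl) _  d₂ _  = d₂ refl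
    three-in-two (inj₂ refl) _          (inj₂ refl) _  d₂ _  = d₂ refl
    three-in-two _          (inj₁ refl) (inj₁ refl) _  _  d₃ = d₃ refl
    three-in-two _          (inj₂ refl) (inj₂ refl) _  _  d₃ = d₃ refl

    drop₁ : ∀ {p q r y : Fin n} → OneOf3 p q r y → p ≢ y → y ≡ q ⊎ y ≡ r
    drop₁ (inj₁ refl) p≢y = ⊥-elim (p≢y refl)
    drop₁ (inj₂ y∈qr) _   = y∈qr

    drop₂ : ∀ {p q r y : Fin n} → OneOf3 p q r y → q ≢ y → y ≡ p ⊎ y ≡ r
    drop₂ (inj₁ y≡p)        _   = inj₁ y≡p
    drop₂ (inj₂ (inj₁ refl)) q≢y = ⊥-elim (q≢y refl)
    drop₂ (inj₂ (inj₂ y≡r)) _   = inj₂ y≡r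

    drop₃ : ∀ {p q r y : Fin n} → OneOf3 p q r y → r ≢ y → y ≡ p ⊎ y ≡ q
    drop₃ (inj₁ y≡p)        _   = inj₁ y≡p
    drop₃ (inj₂ (inj₁ y≡q)) _   = inj₂ y≡q
    drop₃ (inj₂ (inj₂ refl)) r≢y = ⊥-elim (r≢y refl)

  oneOf3-P4-free : ∀ {S : Graph n} {p q r a b c d} →
    OneOf3 p q r a → OneOf3 p q r b → OneOf3 p q r c → OneOf3 p q r d → ¬ IsP4 S a b c d
  oneOf3-P4-free ia ib ic id ((a≢b , a≢c , a≢d , b≢c , b≢d , c≢d) , _) with ia
  ... | inj₁ refl        = three-in-two (drop₁ ib a≢b) (drop₁ ic a≢c) (drop₁ id a≢d) b≢c b≢d c≢d
  ... | inj₂ (inj₁ refl) = three-in-two (drop₂ ib a≢b) (drop₂ ic a≢c) (drop₂ id a≢d) b≢c b≢d c≢d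
  ... | inj₂ (inj₂ refl) = three-in-two (drop₃ ib a≢b) (drop₃ ic a≢c) (drop₃ id a≢d) b≢c b≢d c≢d

  -- The thin spider with S = {p, t}, K = {q, s}, f(p) = q, f(t) = s and an independent R.
  record ThinSpider₂ (S : Graph n) (p q s t : Fin n) (R : Fin n → Set) : Set where
    field
      leg-p  : ∀ {y} → Edge S p y → y ≡ q
      leg-t  : ∀ {y} → Edge S t y → y ≡ s
      body-q : ∀ {y} → Edge S q y → y ≡ p ⊎ y ≡ s ⊎ R y
      body-s : ∀ {y} → Edge S s y → y ≡ t ⊎ y ≡ q ⊎ R y
      head   : ∀ {y y′} → R y → Edge S y y′ → y′ ≡ q ⊎ y′ ≡ s
      head-q : ∀ {y} → R y → Edge S q y
      head-s : ∀ {y} → R y → Edge S s y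
      q-s    : Edge S q s
      cover  : ∀ y → y ≡ p ⊎ y ≡ q ⊎ y ≡ s ⊎ y ≡ t ⊎ R y

  module _ {S : Graph n} where

    ThinSpider₂-mirror : ∀ {p q s t R} → ThinSpider₂ S p q s t R → ThinSpider₂ S t s q p R
    ThinSpider₂-mirror sp = record
      { leg-p  = leg-t
      ; leg-t  = leg-p
      ; body-q = body-s
      ; body-s = body-q
      ; head   = λ r e → Data.Sum.swap (head r e)
      ; head-q = head-s
      ; head-s = head-q
      ; q-s    = edge-sym S q-s
      ; cover  = λ y → reorder (cover y)
      }
      where
      open ThinSpider₂ sp
      reorder : ∀ {A B C D E : Set} → A ⊎ B ⊎ C ⊎ D ⊎ E → D ⊎ C ⊎ B ⊎ A ⊎ E
      reorder (inj₁ a)                       = inj₂ (inj₂ (inj₂ (inj₁ a)))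
      reorder (inj₂ (inj₁ b))                = inj₂ (inj₂ (inj₁ b))
      reorder (inj₂ (inj₂ (inj₁ c)))         = inj₂ (inj₁ c)
      reorder (inj₂ (inj₂ (inj₂ (inj₁ d))))  = inj₁ d
      reorder (inj₂ (inj₂ (inj₂ (inj₂ e))))  = inj₂ (inj₂ (inj₂ (inj₂ e)))

    module _ {p q s t R} (sp : ThinSpider₂ S p q s t R) where
      open ThinSpider₂ sp

      ThinSpider₂-P4-inner : ∀ {a b c d} → IsP4 S a b c d → b ≡ q ⊎ b ≡ s
      ThinSpider₂-P4-inner {a} {b} {c} ((_ , a≢c , _) , (ab , bc , _) , (¬ac , _)) with cover b
      ... | inj₁ refl                       = ⊥-elim (a≢c (trans (leg-p (edge-sym S ab)) (sym (leg-p bc))))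
      ... | inj₂ (inj₁ b≡q)                 = inj₁ b≡q
      ... | inj₂ (inj₂ (inj₁ b≡s))          = inj₂ b≡s
      ... | inj₂ (inj₂ (inj₂ (inj₁ refl)))  = ⊥-elim (a≢c (trans (leg-t (edge-sym S ab)) (sym (leg-t bc))))
      ... | inj₂ (inj₂ (inj₂ (inj₂ rb)))    with head rb (edge-sym S ab) | head rb bc
      ...   | inj₁ refl | inj₁ refl = ⊥-elim (a≢c refl)
      ...   | inj₁ refl | inj₂ refl = ⊥-elim (¬ac q-s)
      ...   | inj₂ refl | inj₁ refl = ⊥-elim (¬ac (edge-sym S q-s))
      ...   | inj₂ refl | inj₂ refl = ⊥-elim (a≢c refl)

      ThinSpider₂-P4-end : ∀ {a d} → IsP4 S a q s d → a ≡ p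
      ThinSpider₂-P4-end ((_ , a≢c , _) , (ab , _) , (¬ac , _)) with body-q (edge-sym S ab)
      ... | inj₁ a≡p         = a≡p
      ... | inj₂ (inj₁ a≡s)  = ⊥-elim (a≢c a≡s)
      ... | inj₂ (inj₂ ra)   = ⊥-elim (¬ac (edge-sym S (head-s ra)))

    ThinSpider₂-P4 : ∀ {p q s t R} → ThinSpider₂ S p q s t R →
                     ∀ {a b c d} → IsP4 S a b c d → set4 a b c d ≡ set4 p q s t
    ThinSpider₂-P4 sp p4@((_ , _ , _ , b≢c , _) , _)
      with ThinSpider₂-P4-inner sp p4 | ThinSpider₂-P4-inner sp (IsP4-reverse {S} p4)
    ... | inj₁ refl | inj₁ refl = ⊥-elim (b≢c refl)
    ... | inj₂ refl | inj₂ refl = ⊥-elim (b≢c refl)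
    ... | inj₁ refl | inj₂ refl
      rewrite ThinSpider₂-P4-end sp p4 | ThinSpider₂-P4-end (ThinSpider₂-mirror sp) (IsP4-reverse {S} p4) = refl
    ... | inj₂ refl | inj₁ refl
      rewrite ThinSpider₂-P4-end sp (IsP4-reverse {S} p4) | ThinSpider₂-P4-end (ThinSpider₂-mirror sp) p4 =
      set4-reverse _ _ _ _

  module _ (G : Graph n) where

    Reach-trans : ∀ {x y z} → Reach G x y → Reach G y z → Reach G x z
    Reach-trans r here         = r
    Reach-trans r (step r′ e) = step (Reach-trans r r′) e

    Reach-sym : ∀ {x y} → Reach G x y → Reach G y x
    Reach-sym here       = here
    Reach-sym (step r e) = Reach-trans (step here (edge-sym G e)) (Reach-sym r)

  IsSolution-swap : ∀ {G S : Graph n} {u v} → IsSolution G u v S → IsSolution G v u S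
  IsSolution-swap {S = S} (sparse , G⊆S , uv) = sparse , G⊆S , edge-sym S uv

  IsOptimal-swap : ∀ {G S : Graph n} {u v} → IsOptimal G u v S → IsOptimal G v u S
  IsOptimal-swap {G} {S} (solution , minimal) =
    IsSolution-swap {G} {S} solution , λ S′ s′ → minimal S′ (IsSolution-swap {G} {S′} s′)

-- The situation at a 1-node root of T_H, with A the leaves of the child containing u and B the rest.
record OptimalJoin {n : ℕ} (G H : Graph n) (u v : Fin n) : Set₁ where
  field
    sparse   : P4Sparse G
    apart    : ¬ Reach G u v
    cover    : ∀ y → Reach G u y ⊎ Reach G v y
    optimal  : IsOptimal G u v H
    A B      : Fin n → Set
    side     : ∀ y → A y ⊎ B y
    disjoint : ∀ {y} → A y → B y → ⊥
    complete : ∀ {a b} → A a → B b → Edge H a b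
    u∈A      : A u
    v∈B      : B v

OptimalJoin-swap : ∀ {n} {G H : Graph n} {u v} → OptimalJoin G H u v → OptimalJoin G H v u
OptimalJoin-swap {G = G} {H} J = record
  { sparse   = sparse
  ; apart    = apart ∘ Reach-sym G
  ; cover    = Data.Sum.swap ∘ cover
  ; optimal  = IsOptimal-swap {G = G} {H} optimal
  ; A        = B
  ; B        = A
  ; side     = Data.Sum.swap ∘ side
  ; disjoint = λ b a → disjoint a b
  ; complete = λ b a → edge-sym H (complete a b)
  ; u∈A      = v∈B
  ; v∈B      = u∈A
  }
  where open OptimalJoin J

module OptimalJoinTheory {n : ℕ} {G H : Graph n} {u v : Fin n} (J : OptimalJoin G H u v) where
  open OptimalJoin J public

  U V : Fin n → Set
  U = Reach G u
  V = Reach G v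

  U∩V-empty : ∀ {y} → U y → V y → ⊥
  U∩V-empty uy vy = apart (Reach-trans G uy (Reach-sym G vy))

  U-V-nonadjacent : ∀ {a b} → U a → V b → ¬ Edge G a b
  U-V-nonadjacent ua vb e = U∩V-empty (step ua e) vb

  U-V-distinct : ∀ {a b} → U a → V b → a ≢ b
  U-V-distinct ua vb refl = U∩V-empty ua vb

  A-B-distinct : ∀ {a b} → A a → B b → a ≢ b
  A-B-distinct aa bb refl = disjoint aa bb

  A? : ∀ y → Dec (A y)
  A? y with side y
  ... | inj₁ ay = yes ay
  ... | inj₂ by = no λ ay → disjoint ay by

  B? : ∀ y → Dec (B y)
  B? y with side y
  ... | inj₁ ay = no λ by → disjoint ay by
  ... | inj₂ by = yes by

  U? : ∀ y → Dec (U y)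
  U? y with cover y
  ... | inj₁ uy = yes uy
  ... | inj₂ vy = no λ uy → U∩V-empty uy vy

  V? : ∀ y → Dec (V y)
  V? y with cover y
  ... | inj₁ uy = no λ vy → U∩V-empty uy vy
  ... | inj₂ vy = yes vy

  sortPair-cross : ∀ {a b a′ b′} → A a → B b → A a′ → B b′ →
                   sortPair a b ≡ sortPair a′ b′ → a ≡ a′ × b ≡ b′
  sortPair-cross aa bb aa′ bb′ eq with sortPair-injective eq
  ... | inj₁ same    = same
  ... | inj₂ (refl , _) = ⊥-elim (disjoint aa bb′)

  cross-fill : ∀ {a b} → A a → B b → ¬ Edge G a b → FillPair G H (sortPair a b)
  cross-fill aa bb ¬e = fillPair-sortPair {G = G} {H = H} (A-B-distinct aa bb) (complete aa bb) ¬e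

  no-cheaper : ∀ {S} → IsSolution G u v S → fillCount G S < fillCount G H → ⊥
  no-cheaper {S} solution cheaper = ℕ.<-irrefl refl (ℕ.<-≤-trans cheaper (proj₂ optimal S solution))

  makeUniversal-solution : IsSolution G u v (makeUniversal G u)
  makeUniversal-solution = makeUniversal-P4Sparse G u sparse , makeUniversal-⊇ G u ,
                           makeUniversal-universal G u v (A-B-distinct u∈A v∈B)

  -- The partner x ∈ B ∩ U is needed only when A meets V.
  module Star (x : Fin n) (x-partner : ∀ {y} → A y → V y → B x × U x) where

    data StarEnds (y : Fin n) : Pair n → Set where
      viaB  : B y → StarEnds y (u , y)
      viaAU : A y → U y → StarEnds y (y , v)
      viaAV : A y → V y → StarEnds y (y , x)

    starEnds : ∀ y → Σ (Pair n) (StarEnds y)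
    starEnds y with side y | cover y
    ... | inj₂ by | _      = _ , viaB by
    ... | inj₁ ay | inj₁ uy = _ , viaAU ay uy
    ... | inj₁ ay | inj₂ vy = _ , viaAV ay vy

    StarEnds-cross : ∀ {y a b} → StarEnds y (a , b) → A a × B b
    StarEnds-cross (viaB by)     = u∈A , by
    StarEnds-cross (viaAU ay _)  = ay , v∈B
    StarEnds-cross (viaAV ay vy) = ay , proj₁ (x-partner ay vy)

    StarEnds-nonEdge : ∀ {y a b} → NonNeighbour G u y → StarEnds y (a , b) → ¬ Edge G a b
    StarEnds-nonEdge (_ , ¬uy) (viaB _)      = ¬uy
    StarEnds-nonEdge _         (viaAU _ uy)  = U-V-nonadjacent uy here
    StarEnds-nonEdge _         (viaAV ay vy) = U-V-nonadjacent (proj₂ (x-partner ay vy)) vy ∘ edge-sym G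

    StarEnds-injective : ∀ {y y′ a b a′ b′} → NonNeighbour G u y → NonNeighbour G u y′ →
                         StarEnds y (a , b) → StarEnds y′ (a′ , b′) → a ≡ a′ → b ≡ b′ → y ≡ y′
    StarEnds-injective _          _          (viaB _)    (viaB _)    _     b≡b′ = b≡b′
    StarEnds-injective _          (y′≢u , _) (viaB _)    (viaAU _ _) u≡y′  _    = ⊥-elim (y′≢u (sym u≡y′))
    StarEnds-injective _          (y′≢u , _) (viaB _)    (viaAV _ _) u≡y′  _    = ⊥-elim (y′≢u (sym u≡y′))
    StarEnds-injective (y≢u , _)  _          (viaAU _ _) (viaB _)    y≡u   _    = ⊥-elim (y≢u y≡u)
    StarEnds-injective (y≢u , _)  _          (viaAV _ _) (viaB _)    y≡u   _    = ⊥-elim (y≢u y≡u)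
    StarEnds-injective _          _          (viaAU _ _) (viaAU _ _) y≡y′  _    = y≡y′
    StarEnds-injective _          _          (viaAU _ _) (viaAV _ _) y≡y′  _    = y≡y′
    StarEnds-injective _          _          (viaAV _ _) (viaAU _ _) y≡y′  _    = y≡y′
    StarEnds-injective _          _          (viaAV _ _) (viaAV _ _) y≡y′  _    = y≡y′

    starPair : Fin n → Pair n
    starPair y = uncurry sortPair (proj₁ (starEnds y))

    starPair-fill : ∀ {y} → NonNeighbour G u y → FillPair G H (starPair y)
    starPair-fill {y} nn with starEnds y
    ... | (a , b) , ends = let aa , bb = StarEnds-cross ends in cross-fill aa bb (StarEnds-nonEdge nn ends)

    starPair-injective : ∀ {y y′} → NonNeighbour G u y → NonNeighbour G u y′ → starPair y ≡ starPair y′ → y ≡ y′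
    starPair-injective {y} {y′} nn nn′ eq with starEnds y | starEnds y′
    ... | (a , b) , ends | (a′ , b′) , ends′ =
          let aa , bb = StarEnds-cross ends ; aa′ , bb′ = StarEnds-cross ends′
              a≡a′ , b≡b′ = sortPair-cross aa bb aa′ bb′ eq
          in StarEnds-injective nn nn′ ends ends′ a≡a′ b≡b′

    StarCharged : Fin n → Fin n → Set
    StarCharged a b = a ≡ u ⊎ (U a × ¬ Edge G u a × b ≡ v) ⊎ (V a × b ≡ x)

    starCharged? : ∀ a b → Dec (StarCharged a b)
    starCharged? a b = (a ≟ u) ⊎-dec ((U? a ×-dec ¬? (edge? G u a) ×-dec (b ≟ v)) ⊎-dec (V? a ×-dec (b ≟ x)))

    starPair-charged : ∀ {y a b} → NonNeighbour G u y → A a → B b → starPair y ≡ sortPair a b → StarCharged a b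
    starPair-charged {y} (_ , ¬uy) aa bb eq with starEnds y
    ... | (a′ , b′) , ends with StarEnds-cross ends
    ... | aa′ , bb′ with sortPair-cross aa′ bb′ aa bb eq
    ... | refl , refl with ends
    ... | viaB _      = inj₁ refl
    ... | viaAU _ uy  = inj₂ (inj₁ (uy , ¬uy , refl))
    ... | viaAV _ vy  = inj₂ (inj₂ (vy , refl))

  makeUniversal-optimal : (∀ {y} → A y → V y → ⊥) → IsOptimal G u v (makeUniversal G u)
  makeUniversal-optimal A∩V-empty =
    makeUniversal-solution ,
    λ S solution → ℕ.≤-trans (makeUniversal-fillCount-≤ G H u starPair starPair-fill starPair-injective)
                             (proj₂ optimal S solution)
    where open Star u (λ ay vy → ⊥-elim (A∩V-empty ay vy))

  -- By optimality, no cross non-edge can be left uncharged: otherwise making u universal is cheaper.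
  cross-nonEdge-charged : ∀ {x} → B x → U x → ∀ {a b} → A a → B b → ¬ Edge G a b →
                          a ≡ u ⊎ (U a × ¬ Edge G u a × b ≡ v) ⊎ (V a × b ≡ x)
  cross-nonEdge-charged {x} bx ux {a} {b} aa bb ¬ab with Star.starCharged? x (λ _ _ → bx , ux) a b
  ... | yes charged = charged
  ... | no uncharged = ⊥-elim (no-cheaper {makeUniversal G u} makeUniversal-solution
          (makeUniversal-fillCount-< G H u starPair starPair-fill starPair-injective
             (sortPair a b) (cross-fill aa bb ¬ab) (λ nn eq → uncharged (starPair-charged nn aa bb eq))))
    where open Star x (λ _ _ → bx , ux)

  CrossNonEdge : Pair n → Set
  CrossNonEdge (a , b) = A a × B b × ¬ Edge G a b

  cross-fill-lowerBound : ∀ ps → Unique ps → All CrossNonEdge ps → length ps ≤ fillCount G H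
  cross-fill-lowerBound ps unique cross =
    subst (_≤ fillCount G H) (length-map (uncurry sortPair) ps)
      (length≤count (map (uncurry sortPair) ps) (keys-unique unique cross) (All.map⁺ (All.map fill cross)))
    where
    fill : ∀ {p} → CrossNonEdge p → FillPair G H (uncurry sortPair p)
    fill {a , b} (aa , bb , ¬e) = cross-fill aa bb ¬e

    keys-distinct : ∀ {p} → CrossNonEdge p → ∀ {q} → p ≢ q × CrossNonEdge q →
                    uncurry sortPair p ≢ uncurry sortPair q
    keys-distinct {a , b} (aa , bb , _) {a′ , b′} (p≢q , aa′ , bb′ , _) eq =
      let a≡a′ , b≡b′ = sortPair-cross aa bb aa′ bb′ eq in p≢q (cong₂ _,_ a≡a′ b≡b′)

    keys-unique : ∀ {ps} → Unique ps → All CrossNonEdge ps → Unique (map (uncurry sortPair) ps)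
    keys-unique []             []           = []
    keys-unique (p∉ ∷ unique)  (cp ∷ cross) =
      All.map⁺ (All.zipWith (keys-distinct cp) (p∉ , cross)) ∷ keys-unique unique cross

  module Charged {x : Fin n} (x∈B : B x) (x∈U : U x) where

    private
      charged : ∀ {a b} → A a → B b → ¬ Edge G a b → a ≡ u ⊎ (U a × ¬ Edge G u a × b ≡ v) ⊎ (V a × b ≡ x)
      charged = cross-nonEdge-charged x∈B x∈U

    B∩U-singleton : ∀ {w x′} → A w → V w → B x′ → U x′ → x′ ≡ x
    B∩U-singleton aw vw bx′ ux′ with charged aw bx′ (U-V-nonadjacent ux′ vw ∘ edge-sym G)
    ... | inj₁ w≡u               = ⊥-elim (U-V-distinct here vw (sym w≡u))
    ... | inj₂ (inj₁ (uw , _))   = ⊥-elim (U∩V-empty uw vw)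
    ... | inj₂ (inj₂ (_ , x′≡x)) = x′≡x

    A∩V-complete-B∩V : ∀ {a b} → A a → V a → B b → V b → Edge G a b
    A∩V-complete-B∩V {a} {b} aa va bb vb with edge? G a b
    ... | yes ab = ab
    ... | no ¬ab with charged aa bb ¬ab
    ...   | inj₁ a≡u              = ⊥-elim (U-V-distinct here va (sym a≡u))
    ...   | inj₂ (inj₁ (ua , _))  = ⊥-elim (U∩V-empty ua va)
    ...   | inj₂ (inj₂ (_ , b≡x)) = ⊥-elim (U-V-distinct x∈U vb (sym b≡x))

    u-no-A-neighbour : ∀ {z} → A z → ¬ Edge G u z
    u-no-A-neighbour az uz with charged az v∈B (U-V-nonadjacent (step here uz) here)
    ... | inj₁ z≡u                 = edge-irrefl G uz (sym z≡u)
    ... | inj₂ (inj₁ (_ , ¬uz , _)) = ¬uz uz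
    ... | inj₂ (inj₂ (vz , _))     = U∩V-empty (step here uz) vz

    B∩V-singleton : ∀ {z y} → A z → U z → z ≢ u → B y → V y → y ≡ v
    B∩V-singleton az uz z≢u by vy with charged az by (U-V-nonadjacent uz vy)
    ... | inj₁ z≡u                = ⊥-elim (z≢u z≡u)
    ... | inj₂ (inj₁ (_ , _ , y≡v)) = y≡v
    ... | inj₂ (inj₂ (vz , _))    = ⊥-elim (U∩V-empty uz vz)

  addEdges-solution : ∀ {ps} → P4Sparse (addEdges G ps) → (u , v) ∈ₗ ps → IsSolution G u v (addEdges G ps)
  addEdges-solution {ps} sparse′ uv∈ps =
    sparse′ , addEdges-⊇ G ps , addEdges-edge⁺ {G = G} {ps = ps} uv∈ps (A-B-distinct u∈A v∈B)

  addEdges-beats : ∀ ps qs → P4Sparse (addEdges G ps) → (u , v) ∈ₗ ps →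
                   Unique qs → All CrossNonEdge qs → length ps < length qs → ⊥
  addEdges-beats ps qs sparse′ uv∈ps unique cross shorter =
    no-cheaper {addEdges G ps} (addEdges-solution sparse′ uv∈ps)
      (ℕ.≤-<-trans (addEdges-fillCount G ps) (ℕ.<-≤-trans shorter (cross-fill-lowerBound qs unique cross)))

-- The case A ∩ U = {u}: then U = {u, x}, V = {w} ∪ (B ∩ V) and N(v) = {w}.
module SingletonA∩U {n : ℕ} {G H : Graph n} {u v : Fin n} (J : OptimalJoin G H u v) where
  open OptimalJoinTheory J
  private module J′ = OptimalJoinTheory (OptimalJoin-swap J)

  module _ {w x : Fin n} (w∈A : A w) (w∈V : V w) (x∈B : B x) (x∈U : U x)
           (A∩U-trivial : ∀ {z} → A z → U z → z ≡ u) where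

    open Charged x∈B x∈U
    private module Swapped = J′.Charged w∈A w∈V

    A∩V-singleton : ∀ {a} → A a → V a → a ≡ w
    A∩V-singleton = Swapped.B∩U-singleton x∈B x∈U

    v-no-B-neighbour : ∀ {z} → B z → ¬ Edge G v z
    v-no-B-neighbour = Swapped.u-no-A-neighbour

    u≢v : u ≢ v
    u≢v = A-B-distinct u∈A v∈B
    u≢x : u ≢ x
    u≢x = A-B-distinct u∈A x∈B
    u≢w : u ≢ w
    u≢w = U-V-distinct here w∈V
    x≢v : x ≢ v
    x≢v = U-V-distinct x∈U here
    x≢w : x ≢ w
    x≢w = U-V-distinct x∈U w∈V
    w≢v : w ≢ v
    w≢v = A-B-distinct w∈A v∈B

    classify : ∀ t → t ≡ u ⊎ t ≡ x ⊎ t ≡ w ⊎ (B t × V t)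
    classify t with side t | cover t
    ... | inj₁ at | inj₁ ut = inj₁ (A∩U-trivial at ut)
    ... | inj₁ at | inj₂ vt = inj₂ (inj₂ (inj₁ (A∩V-singleton at vt)))
    ... | inj₂ bt | inj₁ ut = inj₂ (inj₁ (B∩U-singleton w∈A w∈V bt ut))
    ... | inj₂ bt | inj₂ vt = inj₂ (inj₂ (inj₂ (bt , vt)))

    x-neighbour : ∀ {t} → Edge G x t → t ≡ u
    x-neighbour {t} e with side t
    ... | inj₁ at = A∩U-trivial at (step x∈U e)
    ... | inj₂ bt = ⊥-elim (edge-irrefl G e (sym (B∩U-singleton w∈A w∈V bt (step x∈U e))))

    u-neighbour : ∀ {t} → Edge G u t → t ≡ x
    u-neighbour {t} e with side t
    ... | inj₁ at = ⊥-elim (u-no-A-neighbour at e)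
    ... | inj₂ bt = B∩U-singleton w∈A w∈V bt (step here e)

    v-neighbour : ∀ {t} → Edge G v t → t ≡ w
    v-neighbour {t} e with side t
    ... | inj₁ at = A∩V-singleton at (step here e)
    ... | inj₂ bt = ⊥-elim (v-no-B-neighbour bt e)

    w-neighbour : ∀ {t} → Edge G w t → B t × V t
    w-neighbour {t} e with classify t
    ... | inj₁ refl                = ⊥-elim (U-V-nonadjacent here w∈V (edge-sym G e))
    ... | inj₂ (inj₁ refl)         = ⊥-elim (U-V-nonadjacent x∈U w∈V (edge-sym G e))
    ... | inj₂ (inj₂ (inj₁ refl))  = ⊥-elim (edge-irrefl G e refl)
    ... | inj₂ (inj₂ (inj₂ bv))    = bv

    w-complete : ∀ {y} → B y → V y → Edge G w y
    w-complete = A∩V-complete-B∩V w∈A w∈V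

    cross-uy : ∀ {y} → B y → V y → CrossNonEdge (u , y)
    cross-uy by vy = u∈A , by , U-V-nonadjacent here vy

    cross-wx : CrossNonEdge (w , x)
    cross-wx = w∈A , x∈B , U-V-nonadjacent x∈U w∈V ∘ edge-sym G

    -- B ∩ V = {v}: adding uv turns G into the path x u v w, at cost 1 < |{uv, wx}|.
    module OneInB∩V (B∩V-trivial : ∀ {y} → B y → V y → y ≡ v) where
      ps : List (Pair n)
      ps = (u , v) ∷ []

      S : Graph n
      S = addEdges G ps

      leg-x : ∀ {y} → Edge S x y → y ≡ u
      leg-x e with addEdges-edge⁻ {G = G} {ps = ps} e
      ... | inj₁ g                          = x-neighbour g
      ... | inj₂ (here (inj₁ (x≡u , _)))    = ⊥-elim (u≢x (sym x≡u))
      ... | inj₂ (here (inj₂ (x≡v , _)))    = ⊥-elim (x≢v x≡v)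

      leg-w : ∀ {y} → Edge S w y → y ≡ v
      leg-w e with addEdges-edge⁻ {G = G} {ps = ps} e
      ... | inj₁ g                          = uncurry B∩V-trivial (w-neighbour g)
      ... | inj₂ (here (inj₁ (w≡u , _)))    = ⊥-elim (u≢w (sym w≡u))
      ... | inj₂ (here (inj₂ (w≡v , _)))    = ⊥-elim (w≢v w≡v)

      body-u : ∀ {y} → Edge S u y → y ≡ x ⊎ y ≡ v ⊎ ⊥
      body-u e with addEdges-edge⁻ {G = G} {ps = ps} e
      ... | inj₁ g                          = inj₁ (u-neighbour g)
      ... | inj₂ (here (inj₁ (_ , y≡v)))    = inj₂ (inj₁ y≡v)
      ... | inj₂ (here (inj₂ (u≡v , _)))    = ⊥-elim (u≢v u≡v)

      body-v : ∀ {y} → Edge S v y → y ≡ w ⊎ y ≡ u ⊎ ⊥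
      body-v e with addEdges-edge⁻ {G = G} {ps = ps} e
      ... | inj₁ g                          = inj₁ (v-neighbour g)
      ... | inj₂ (here (inj₁ (v≡u , _)))    = ⊥-elim (u≢v (sym v≡u))
      ... | inj₂ (here (inj₂ (_ , y≡u)))    = inj₂ (inj₁ y≡u)

      spider : ThinSpider₂ S x u v w (λ _ → ⊥)
      spider = record
        { leg-p  = leg-x
        ; leg-t  = leg-w
        ; body-q = body-u
        ; body-s = body-v
        ; head   = λ ()
        ; head-q = λ ()
        ; head-s = λ ()
        ; q-s    = addEdges-edge⁺ {G = G} {ps = ps} (here refl) u≢v
        ; cover  = cover′
        }
        where
        cover′ : ∀ y → y ≡ x ⊎ y ≡ u ⊎ y ≡ v ⊎ y ≡ w ⊎ ⊥
        cover′ y with classify y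
        ... | inj₁ y≡u                    = inj₂ (inj₁ y≡u)
        ... | inj₂ (inj₁ y≡x)             = inj₁ y≡x
        ... | inj₂ (inj₂ (inj₁ y≡w))      = inj₂ (inj₂ (inj₂ (inj₁ y≡w)))
        ... | inj₂ (inj₂ (inj₂ (by , vy))) = inj₂ (inj₂ (inj₁ (B∩V-trivial by vy)))

      impossible : ⊥
      impossible = addEdges-beats ps ((u , v) ∷ (w , x) ∷ [])
        (P4Sparse-single {S = S} _ (ThinSpider₂-P4 spider)) (here refl)
        (((u≢w ∘ ,-injectiveˡ) ∷ []) ∷ [] ∷ [])
        (cross-uy v∈B here ∷ cross-wx ∷ [])
        (ℕ.n<1+n 1)

    -- B ∩ V = {v, y₁}: adding uv and uw gives the path x u w y₁ with v adjacent to u and w,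
    -- at cost 2 < |{uv, uy₁, wx}|.
    module TwoInB∩V {y₁ : Fin n} (y₁∈B : B y₁) (y₁∈V : V y₁) (y₁≢v : y₁ ≢ v)
                    (B∩V-pair : ∀ {y} → B y → V y → y ≢ v → y ≡ y₁) where
      ps : List (Pair n)
      ps = (u , v) ∷ (u , w) ∷ []

      S : Graph n
      S = addEdges G ps

      B∩V-split : ∀ {y} → B y → V y → y ≡ v ⊎ y ≡ y₁
      B∩V-split {y} by vy with y ≟ v
      ... | yes y≡v = inj₁ y≡v
      ... | no y≢v  = inj₂ (B∩V-pair by vy y≢v)

      leg-x : ∀ {y} → Edge S x y → y ≡ u
      leg-x e with addEdges-edge⁻ {G = G} {ps = ps} e
      ... | inj₁ g                                = x-neighbour g
      ... | inj₂ (here (inj₁ (x≡u , _)))          = ⊥-elim (u≢x (sym x≡u))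
      ... | inj₂ (here (inj₂ (x≡v , _)))          = ⊥-elim (x≢v x≡v)
      ... | inj₂ (there (here (inj₁ (x≡u , _))))  = ⊥-elim (u≢x (sym x≡u))
      ... | inj₂ (there (here (inj₂ (x≡w , _))))  = ⊥-elim (x≢w x≡w)

      leg-y₁ : ∀ {y} → Edge S y₁ y → y ≡ w
      leg-y₁ {y} e with addEdges-edge⁻ {G = G} {ps = ps} e
      ... | inj₂ (here (inj₁ (y₁≡u , _)))         = ⊥-elim (A-B-distinct u∈A y₁∈B (sym y₁≡u))
      ... | inj₂ (here (inj₂ (y₁≡v , _)))         = ⊥-elim (y₁≢v y₁≡v)
      ... | inj₂ (there (here (inj₁ (y₁≡u , _)))) = ⊥-elim (A-B-distinct u∈A y₁∈B (sym y₁≡u))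
      ... | inj₂ (there (here (inj₂ (y₁≡w , _)))) = ⊥-elim (A-B-distinct w∈A y₁∈B (sym y₁≡w))
      ... | inj₁ g with classify y
      ...   | inj₁ refl                          = ⊥-elim (U-V-nonadjacent here y₁∈V (edge-sym G g))
      ...   | inj₂ (inj₁ refl)                   = ⊥-elim (U-V-nonadjacent x∈U y₁∈V (edge-sym G g))
      ...   | inj₂ (inj₂ (inj₁ y≡w))             = y≡w
      ...   | inj₂ (inj₂ (inj₂ (by , vy))) with B∩V-split by vy
      ...     | inj₁ refl = ⊥-elim (v-no-B-neighbour y₁∈B (edge-sym G g))
      ...     | inj₂ refl = ⊥-elim (edge-irrefl G g refl)

      body-u : ∀ {y} → Edge S u y → y ≡ x ⊎ y ≡ w ⊎ y ≡ v
      body-u e with addEdges-edge⁻ {G = G} {ps = ps} e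
      ... | inj₁ g                                = inj₁ (u-neighbour g)
      ... | inj₂ (here (inj₁ (_ , y≡v)))          = inj₂ (inj₂ y≡v)
      ... | inj₂ (here (inj₂ (u≡v , _)))          = ⊥-elim (u≢v u≡v)
      ... | inj₂ (there (here (inj₁ (_ , y≡w))))  = inj₂ (inj₁ y≡w)
      ... | inj₂ (there (here (inj₂ (u≡w , _))))  = ⊥-elim (u≢w u≡w)

      body-w : ∀ {y} → Edge S w y → y ≡ y₁ ⊎ y ≡ u ⊎ y ≡ v
      body-w e with addEdges-edge⁻ {G = G} {ps = ps} e
      ... | inj₁ g with uncurry B∩V-split (w-neighbour g)
      ...   | inj₁ y≡v                            = inj₂ (inj₂ y≡v)
      ...   | inj₂ y≡y₁                           = inj₁ y≡y₁
      body-w e | inj₂ (here (inj₁ (w≡u , _)))         = ⊥-elim (u≢w (sym w≡u))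
      body-w e | inj₂ (here (inj₂ (w≡v , _)))         = ⊥-elim (w≢v w≡v)
      body-w e | inj₂ (there (here (inj₁ (w≡u , _)))) = ⊥-elim (u≢w (sym w≡u))
      body-w e | inj₂ (there (here (inj₂ (_ , y≡u)))) = inj₂ (inj₁ y≡u)

      head-v : ∀ {y y′} → y ≡ v → Edge S y y′ → y′ ≡ u ⊎ y′ ≡ w
      head-v refl e with addEdges-edge⁻ {G = G} {ps = ps} e
      ... | inj₁ g                                = inj₂ (v-neighbour g)
      ... | inj₂ (here (inj₁ (v≡u , _)))          = ⊥-elim (u≢v (sym v≡u))
      ... | inj₂ (here (inj₂ (_ , y′≡u)))         = inj₁ y′≡u
      ... | inj₂ (there (here (inj₁ (v≡u , _))))  = ⊥-elim (u≢v (sym v≡u))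
      ... | inj₂ (there (here (inj₂ (v≡w , _))))  = ⊥-elim (w≢v (sym v≡w))

      spider : ThinSpider₂ S x u w y₁ (_≡ v)
      spider = record
        { leg-p  = leg-x
        ; leg-t  = leg-y₁
        ; body-q = body-u
        ; body-s = body-w
        ; head   = head-v
        ; head-q = λ { refl → addEdges-edge⁺ {G = G} {ps = ps} (here refl) u≢v }
        ; head-s = λ { refl → addEdges-⊇ G ps _ _ (w-complete v∈B here) }
        ; q-s    = addEdges-edge⁺ {G = G} {ps = ps} (there (here refl)) u≢w
        ; cover  = cover′
        }
        where
        cover′ : ∀ y → y ≡ x ⊎ y ≡ u ⊎ y ≡ w ⊎ y ≡ y₁ ⊎ y ≡ v
        cover′ y with classify y
        ... | inj₁ y≡u                     = inj₂ (inj₁ y≡u)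
        ... | inj₂ (inj₁ y≡x)              = inj₁ y≡x
        ... | inj₂ (inj₂ (inj₁ y≡w))       = inj₂ (inj₂ (inj₁ y≡w))
        ... | inj₂ (inj₂ (inj₂ (by , vy))) with B∩V-split by vy
        ...   | inj₁ y≡v  = inj₂ (inj₂ (inj₂ (inj₂ y≡v)))
        ...   | inj₂ y≡y₁ = inj₂ (inj₂ (inj₂ (inj₁ y≡y₁)))

      impossible : ⊥
      impossible = addEdges-beats ps ((u , v) ∷ (u , y₁) ∷ (w , x) ∷ [])
        (P4Sparse-single {S = S} _ (ThinSpider₂-P4 spider)) (here refl)
        (((y₁≢v ∘ sym ∘ ,-injectiveʳ) ∷ (u≢w ∘ ,-injectiveˡ) ∷ []) ∷
         ((u≢w ∘ ,-injectiveˡ) ∷ []) ∷ [] ∷ [])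
        (cross-uy v∈B here ∷ cross-uy y₁∈B y₁∈V ∷ cross-wx ∷ [])
        (ℕ.n<1+n 2)

    -- B ∩ V ⊇ {v, y₁, y₂}: adding uv, uw and xw makes w universal over the island x u v and
    -- the rest of G, at cost 3 < |{uv, uy₁, uy₂, wx}|.
    module ManyInB∩V {y₁ y₂ : Fin n} (y₁∈B : B y₁) (y₁∈V : V y₁) (y₁≢v : y₁ ≢ v)
                     (y₂∈B : B y₂) (y₂∈V : V y₂) (y₂≢v : y₂ ≢ v) (y₂≢y₁ : y₂ ≢ y₁) where
      ps : List (Pair n)
      ps = (u , v) ∷ (u , w) ∷ (x , w) ∷ []

      S : Graph n
      S = addEdges G ps

      Island : Fin n → Set
      Island = OneOf3 x u v

      added-end : ∀ {a b} → Any (λ e → Link (proj₁ e) (proj₂ e) a b) ps → Island a ⊎ a ≡ w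
      added-end (here (inj₁ (a≡u , _)))                 = inj₁ (inj₂ (inj₁ a≡u))
      added-end (here (inj₂ (a≡v , _)))                 = inj₁ (inj₂ (inj₂ a≡v))
      added-end (there (here (inj₁ (a≡u , _))))         = inj₁ (inj₂ (inj₁ a≡u))
      added-end (there (here (inj₂ (a≡w , _))))         = inj₂ a≡w
      added-end (there (there (here (inj₁ (a≡x , _))))) = inj₁ (inj₁ a≡x)
      added-end (there (there (here (inj₂ (a≡w , _))))) = inj₂ a≡w

      w-universal : ∀ t → w ≢ t → Edge S w t
      w-universal t w≢t with classify t
      ... | inj₁ refl                    = edge-sym S (addEdges-edge⁺ {G = G} {ps = ps} (there (here refl)) u≢w)
      ... | inj₂ (inj₁ refl)             = edge-sym S (addEdges-edge⁺ {G = G} {ps = ps} (there (there (here refl))) x≢w)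
      ... | inj₂ (inj₂ (inj₁ t≡w))       = ⊥-elim (w≢t (sym t≡w))
      ... | inj₂ (inj₂ (inj₂ (bt , vt))) = addEdges-⊇ G ps _ _ (w-complete bt vt)

      separated : ∀ {y y′} → y ≢ w → ¬ Island y → Island y′ → ¬ Edge S y y′
      separated y≢w ¬iy iy′ e with addEdges-edge⁻ {G = G} {ps = ps} e
      ... | inj₂ added with added-end added
      ...   | inj₁ iy  = ¬iy iy
      ...   | inj₂ y≡w = y≢w y≡w
      separated y≢w ¬iy (inj₁ refl)        e | inj₁ g = ¬iy (inj₂ (inj₁ (x-neighbour (edge-sym G g))))
      separated y≢w ¬iy (inj₂ (inj₁ refl)) e | inj₁ g = ¬iy (inj₁ (u-neighbour (edge-sym G g)))
      separated y≢w ¬iy (inj₂ (inj₂ refl)) e | inj₁ g = y≢w (v-neighbour (edge-sym G g))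

      S⇒G : ∀ {a b} → a ≢ w → ¬ Island a → b ≢ w → ¬ Island b → Edge S a b → Edge G a b
      S⇒G a≢w ¬ia _ _ e with addEdges-edge⁻ {G = G} {ps = ps} e
      ... | inj₁ g = g
      ... | inj₂ added with added-end added
      ...   | inj₁ ia  = ⊥-elim (¬ia ia)
      ...   | inj₂ a≡w = ⊥-elim (a≢w a≡w)

      impossible : ⊥
      impossible = addEdges-beats ps ((u , v) ∷ (u , y₁) ∷ (u , y₂) ∷ (w , x) ∷ [])
        (P4Sparse-reflect {S = S} {G = G}
          (universal-island-P4 {S = S} {G = G} w Island (oneOf3? x u v) w-universal separated
             (oneOf3-P4-free {S = S}) S⇒G (addEdges-⊇ G ps))
          sparse)
        (here refl)
        (((y₁≢v ∘ sym ∘ ,-injectiveʳ) ∷ (y₂≢v ∘ sym ∘ ,-injectiveʳ) ∷ (u≢w ∘ ,-injectiveˡ) ∷ []) ∷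
         ((y₂≢y₁ ∘ sym ∘ ,-injectiveʳ) ∷ (u≢w ∘ ,-injectiveˡ) ∷ []) ∷
         ((u≢w ∘ ,-injectiveˡ) ∷ []) ∷ [] ∷ [])
        (cross-uy v∈B here ∷ cross-uy y₁∈B y₁∈V ∷ cross-uy y₂∈B y₂∈V ∷ cross-wx ∷ [])
        (ℕ.n<1+n 3)

    impossible : ⊥
    impossible with any? (λ y → B? y ×-dec V? y ×-dec ¬? (y ≟ v))
    ... | no none = OneInB∩V.impossible λ by vy → decidable-stable (_ ≟ v) (λ y≢v → none (_ , by , vy , y≢v))
    ... | yes (y₁ , y₁∈B , y₁∈V , y₁≢v)
      with any? (λ y → B? y ×-dec V? y ×-dec ¬? (y ≟ v) ×-dec ¬? (y ≟ y₁))
    ...   | yes (y₂ , y₂∈B , y₂∈V , y₂≢v , y₂≢y₁) =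
              ManyInB∩V.impossible y₁∈B y₁∈V y₁≢v y₂∈B y₂∈V y₂≢v y₂≢y₁
    ...   | no none = TwoInB∩V.impossible y₁∈B y₁∈V y₁≢v
              λ by vy y≢v → decidable-stable (_ ≟ y₁) (λ y≢y₁ → none (_ , by , vy , y≢v , y≢y₁))

module _ {n : ℕ} {G H : Graph n} {u v : Fin n} (J : OptimalJoin G H u v) where
  open OptimalJoinTheory J

  -- If A ∩ U ≠ {u} then B ∩ V = {v}, which is the case A ∩ U = {u} with the roles of u and v swapped.
  crossing-impossible : ¬ ((Σ (Fin n) λ w → A w × V w) × (Σ (Fin n) λ x → B x × U x))
  crossing-impossible ((w , w∈A , w∈V) , (x , x∈B , x∈U)) with any? (λ z → A? z ×-dec U? z ×-dec ¬? (z ≟ u))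
  ... | no none = SingletonA∩U.impossible J w∈A w∈V x∈B x∈U
                    λ az uz → decidable-stable (_ ≟ u) (λ z≢u → none (_ , az , uz , z≢u))
  ... | yes (z , z∈A , z∈U , z≢u) = SingletonA∩U.impossible (OptimalJoin-swap J) x∈B x∈U w∈A w∈V
                    (Charged.B∩V-singleton x∈B x∈U z∈A z∈U z≢u)

  optimal-makeUniversal : Σ (Graph n) λ H′ → IsOptimal G u v H′ × (MakesUniversal G u H′ ⊎ MakesUniversal G v H′)
  optimal-makeUniversal with any? (λ w → A? w ×-dec V? w)
  ... | no none = makeUniversal G u , makeUniversal-optimal (λ aw vw → none (_ , aw , vw)) ,
                  inj₁ (makeUniversal-spec G u)
  ... | yes A∩V with any? (λ x → B? x ×-dec U? x)
  ...   | no none = makeUniversal G v ,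
                    IsOptimal-swap {G = G} {makeUniversal G v}
                      (OptimalJoinTheory.makeUniversal-optimal (OptimalJoin-swap J) (λ bx ux → none (_ , bx , ux))) ,
                    inj₂ (makeUniversal-spec G v)
  ...   | yes B∩U = ⊥-elim (crossing-impossible (A∩V , B∩U))

module _ {n : ℕ} where

  ∈-toSubset⁺ : ∀ {x : Fin n} {xs} → x ∈ₗ xs → x ∈ toSubset xs
  ∈-toSubset⁺ {x} (here refl)   = x∈p∪q⁺ (inj₁ (x∈⁅x⁆ x))
  ∈-toSubset⁺     (there x∈xs) = x∈p∪q⁺ (inj₂ (∈-toSubset⁺ x∈xs))

  ∈-toSubset⁻ : ∀ {x : Fin n} xs → x ∈ toSubset xs → x ∈ₗ xs
  ∈-toSubset⁻ []       x∈ = ⊥-elim (∉⊥ x∈)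
  ∈-toSubset⁻ (y ∷ ys) x∈ with x∈p∪q⁻ ⁅ y ⁆ (toSubset ys) x∈
  ... | inj₁ x∈⁅y⁆ = here (x∈⁅y⁆⇒x≡y y x∈⁅y⁆)
  ... | inj₂ x∈ys  = there (∈-toSubset⁻ ys x∈ys)

  ∈-leavesL⁻ : ∀ {x : Fin n} ts → x ∈ₗ leavesL ts → Σ (Fin (length ts)) λ k → x ∈ₗ leaves (lookup ts k)
  ∈-leavesL⁻ (t ∷ ts) x∈ with ∈-++⁻ (leaves t) x∈
  ... | inj₁ x∈t  = zero , x∈t
  ... | inj₂ x∈ts = let k , x∈k = ∈-leavesL⁻ ts x∈ts in suc k , x∈k

  rootJoin : ∀ {G H : Graph n} {u v} → P4Sparse G → TwoComponents G u v → IsOptimal G u v H →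
             ∀ {ts} → NodeCond H L1 ts → leavesL ts ↭ allFin n → ∀ {i j} → i ≢ j →
             u ∈ₗ leaves (lookup ts i) → v ∈ₗ leaves (lookup ts j) → OptimalJoin G H u v
  rootJoin {G} {H} {u} {v} sparse (apart , cover) optimal {ts} join leaves↭ {i} {j} i≢j u∈i v∈j =
    record
      { sparse   = sparse
      ; apart    = apart
      ; cover    = cover
      ; optimal  = optimal
      ; A        = _∈ Aᵢ
      ; B        = _∉ Aᵢ
      ; side     = side
      ; disjoint = λ a∈ a∉ → a∉ a∈
      ; complete = complete
      ; u∈A      = ∈-toSubset⁺ u∈i
      ; v∈B      = λ v∈ → edge-irrefl H (join i j i≢j v v (∈-toSubset⁻ _ v∈) v∈j) refl
      }
    where
    Aᵢ : Subset n
    Aᵢ = toSubset (leaves (lookup ts i))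

    side : ∀ y → y ∈ Aᵢ ⊎ y ∉ Aᵢ
    side y with y ∈? Aᵢ
    ... | yes y∈ = inj₁ y∈
    ... | no y∉  = inj₂ y∉

    complete : ∀ {a b} → a ∈ Aᵢ → b ∉ Aᵢ → Edge H a b
    complete {a} {b} a∈ b∉ with ∈-leavesL⁻ ts (∈-resp-↭ (↭-sym leaves↭) (∈-allFin b))
    ... | k , b∈k with k ≟ i
    ...   | yes refl = ⊥-elim (b∉ (∈-toSubset⁺ b∈k))
    ...   | no k≢i   = join i k (k≢i ∘ sym) a b (∈-toSubset⁻ _ a∈) b∈k

lemma3 : ∀ {n : ℕ} (G : Graph n) (u v : Fin n) →
    P4Sparse G → TwoComponents G u v →
    ∀ (H : Graph n) → IsOptimal G u v H →
    ∀ (ts : List Tree) → IsP4SparseTree H (node L1 ts) →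
    ∀ (i j : Fin (length ts)) → i ≢ j →
    u LM.∈ leaves (lookup ts i) → v LM.∈ leaves (lookup ts j) →
    ¬ ((Σ (Fin n) λ w → w ∈ toSubset (leaves (lookup ts i)) × Reach G v w) ×
       (Σ (Fin n) λ w → w ∉ toSubset (leaves (lookup ts i)) × Reach G u w))
    × (Σ (Graph n) λ H' → IsOptimal G u v H' × (MakesUniversal G u H' ⊎ MakesUniversal G v H'))
lemma3 G u v sparse twoComponents H optimal ts (nodeWF _ _ _ _ _ join , leaves↭) i j i≢j u∈i v∈j =
  crossing-impossible J , optimal-makeUniversal J
  where
  J : OptimalJoin G H u v
  J = rootJoin sparse twoComponents optimal {ts} join leaves↭ i≢j u∈i v∈j
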